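{- Let $\mathbb{F}$ be a field of characteristic $0$, let $a,d\in\mathbb{F}$ be such that $a+nd\neq 0$ for all $n\in\mathbb{Z}$, and let $f\colon\mathbb{F}\to\mathbb{F}$ be an SD map with $f(a)=a$, $f(a+d)=a+d$ and $f(d)=d$. Then $f(a+nd)=a+nd$ for all $n\in\mathbb{Z}$.
   Context: An SD map on a field $\mathbb{F}$ is a function $f\colon \mathbb{F}\to\mathbb{F}$ such that for all $x \neq y$ in $\mathbb{F}$ one has $f(x)\neq f(y)$ and $f\left(\frac{x+y}{x-y}\right) = \frac{f(x)+f(y)}{f(x)-f(y)}$. -}

module Defs where

open import Level using (Level; suc; _⊔_)
open import Relation.Binary.PropositionalEquality using (_≡_)
open import Relation.Nullary using (¬_)
open import Algebra.Structures using (IsCommutativeRing)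
open import Data.Product using (_×_)
open import Data.Nat as ℕ using (ℕ)
open import Data.Integer as ℤ using (ℤ; +_; -[1+_])

-- The inverse is given as a total function _⁻¹ whose value at 0 is irrelevant
-- (it is only ever used at nonzero arguments below).
record Field (c : Level) : Set (suc c) where
  infix  8 -_
  infixl 7 _*_
  infixl 6 _+_
  infix  9 _⁻¹
  field
    Carrier : Set c
    _+_ _*_ : Carrier → Carrier → Carrier
    -_      : Carrier → Carrier
    0# 1#   : Carrier
    _⁻¹     : Carrier → Carrier
    isCommutativeRing : IsCommutativeRing _≡_ _+_ _*_ -_ 0# 1#
    0≢1     : ¬ (0# ≡ 1#)
    ⁻¹-inverse : ∀ x → ¬ (x ≡ 0#) → x * (x ⁻¹) ≡ 1#

  open IsCommutativeRing isCommutativeRing public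

  infixl 7 _/_
  _/_ : Carrier → Carrier → Carrier
  x / y = x * (y ⁻¹)

  fromℕ : ℕ → Carrier
  fromℕ ℕ.zero    = 0#
  fromℕ (ℕ.suc n) = 1# + fromℕ n

  fromℤ : ℤ → Carrier
  fromℤ (+ n)      = fromℕ n
  fromℤ -[1+ n ]   = - fromℕ (ℕ.suc n)

  CharZero : Set c
  CharZero = ∀ (n : ℕ) → ¬ (fromℕ (ℕ.suc n) ≡ 0#)

  IsSDMap : (Carrier → Carrier) → Set c
  IsSDMap f = ∀ x y → ¬ (x ≡ y) →
    ¬ (f x ≡ f y) × (f ((x + y) / (x - y)) ≡ (f x + f y) / (f x - f y))

{-# OPTIONS --safe #-}
module Submission where

-- Write sd x y = (x + y) / (x - y), so that an SD map satisfies
-- f (sd x y) = sd (f x) (f y). When 2 ≠ 0 and c ≠ 0, both x ↦ sd x c and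
-- x ↦ sd c x are injective, so f fixes x as soon as it fixes c and the sd of
-- x with c. From 1 = sd 1 0 = sd (-1) 0 and 0 = sd x (-x) one gets f 0 = 0,
-- f 1 = 1 and f (-x) = -f x, and sd d q = sd (d / q) 1 shows that d / q is
-- fixed whenever q and d are. Finally sd (u + d) (-(u - d)) = d / u =
-- sd (-(u + d)) (u - d): if d and two consecutive terms u - d, u (resp. u, u + d)
-- of the progression are fixed, then so is u + d (resp. u - d). Induction in
-- both directions from a and a + d covers every a + n d.

open import Defs
open import Level using (Level)
open import Relation.Binary.PropositionalEquality
  using (_≡_; _≢_; refl; sym; trans; cong; cong₂; subst; module ≡-Reasoning)
open import Relation.Nullary using (¬_)
open import Relation.Nullary.Decidable using (dec⇒maybe)
open import Data.Product using (_×_; _,_; proj₁; proj₂)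
import Data.Maybe as Maybe
open import Data.Nat as ℕ using (ℕ; zero; suc)
open import Data.Integer as ℤ using (ℤ; -[1+_]; +0; 0ℤ; 1ℤ; -1ℤ; _⊖_)
open import Data.Integer.Properties
  using ([1+m]⊖[1+n]≡m⊖n; pos-*; neg-distribˡ-*; neg-distribʳ-*)
open import Data.Nat.Properties using (+-suc)
open import Algebra.Bundles using (CommutativeRing)
open import Algebra.Solver.Ring.AlmostCommutativeRing
  using (_-Raw-AlmostCommutative⟶_; fromCommutativeRing)
import Algebra.Solver.Ring as RingSolver
import Algebra.Properties.Ring as RingProperties
import Algebra.Properties.CommutativeSemigroup as CommutativeSemigroupProperties
import Algebra.Properties.Semiring.Mult as SemiringMultiplication

ℤ-twoStep-induction : ∀ {p} (P : ℤ → Set p) → P 0ℤ → P 1ℤ →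
  (∀ i → P (ℤ.pred i) → P i → P (ℤ.suc i)) →
  (∀ i → P (ℤ.suc i) → P i → P (ℤ.pred i)) →
  ∀ i → P i
-- ℤ.pred (+ suc n) and ℤ.suc -[1+ suc n ] compute to + n and -[1+ n ].
ℤ-twoStep-induction P P0 P1 up down (ℤ.+ n)  = proj₁ (upward n)
  where
  upward : ∀ n → P (ℤ.+ n) × P (ℤ.+ suc n)
  upward zero    = P0 , P1
  upward (suc n) = let (lower , upper) = upward n in upper , up (ℤ.+ suc n) lower upper
ℤ-twoStep-induction P P0 P1 up down -[1+ n ] = proj₁ (downward n)
  where
  downward : ∀ n → P -[1+ n ] × P (ℤ.suc -[1+ n ])
  downward zero    = down 0ℤ P1 P0 , P0
  downward (suc n) = let (lower , upper) = downward n in down -[1+ n ] upper lower , lower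

module FieldProperties {c : Level} (F : Field c) where
  open Field F hiding (refl; sym; trans)
  open ≡-Reasoning

  commutativeRing : CommutativeRing c c
  commutativeRing = record { isCommutativeRing = isCommutativeRing }

  open CommutativeRing commutativeRing
    using (ring; semiring; +-commutativeSemigroup; *-commutativeSemigroup)
  open RingProperties ring
    using (-0#≈0#; -‿involutive; -‿+-comm; -‿distribˡ-*; -‿distribʳ-*; x[y-z]≈xy-xz;
           x∙y⁻¹≈ε⇒x≈y; +-inverseʳ-unique)
  open CommutativeSemigroupProperties +-commutativeSemigroup using () renaming (interchange to +-interchange)
  open CommutativeSemigroupProperties *-commutativeSemigroup using (xy∙z≈xz∙y)
  open SemiringMultiplication semiring using (×-homo-+; ×1-homo-*) renaming (_×_ to _×ᵤ_)

  fromℕ≡n×ᵤ1 : ∀ n → fromℕ n ≡ n ×ᵤ 1#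
  fromℕ≡n×ᵤ1 zero    = refl
  fromℕ≡n×ᵤ1 (suc n) = cong (1# +_) (fromℕ≡n×ᵤ1 n)

  fromℕ-+ : ∀ m n → fromℕ (m ℕ.+ n) ≡ fromℕ m + fromℕ n
  fromℕ-+ m n = begin
    fromℕ (m ℕ.+ n)         ≡⟨ fromℕ≡n×ᵤ1 (m ℕ.+ n) ⟩
    (m ℕ.+ n) ×ᵤ 1#         ≡⟨ ×-homo-+ 1# m n ⟩
    m ×ᵤ 1# + n ×ᵤ 1#       ≡⟨ sym (cong₂ _+_ (fromℕ≡n×ᵤ1 m) (fromℕ≡n×ᵤ1 n)) ⟩
    fromℕ m + fromℕ n       ∎

  fromℕ-* : ∀ m n → fromℕ (m ℕ.* n) ≡ fromℕ m * fromℕ n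
  fromℕ-* m n = begin
    fromℕ (m ℕ.* n)         ≡⟨ fromℕ≡n×ᵤ1 (m ℕ.* n) ⟩
    (m ℕ.* n) ×ᵤ 1#         ≡⟨ ×1-homo-* m n ⟩
    (m ×ᵤ 1#) * (n ×ᵤ 1#)   ≡⟨ sym (cong₂ _*_ (fromℕ≡n×ᵤ1 m) (fromℕ≡n×ᵤ1 n)) ⟩
    fromℕ m * fromℕ n       ∎

  [1+x]-[1+y]≡x-y : ∀ x y → (1# + x) - (1# + y) ≡ x - y
  [1+x]-[1+y]≡x-y x y = begin
    (1# + x) + - (1# + y)      ≡⟨ cong ((1# + x) +_) (sym (-‿+-comm 1# y)) ⟩
    (1# + x) + (- 1# + - y)    ≡⟨ +-interchange 1# x (- 1#) (- y) ⟩
    (1# + - 1#) + (x - y)      ≡⟨ cong (_+ (x - y)) (-‿inverseʳ 1#) ⟩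
    0# + (x - y)               ≡⟨ +-identityˡ (x - y) ⟩
    x - y                      ∎

  fromℤ-⊖ : ∀ m n → fromℤ (m ⊖ n) ≡ fromℕ m - fromℕ n
  fromℤ-⊖ zero    zero    = sym (-‿inverseʳ 0#)
  fromℤ-⊖ zero    (suc n) = sym (+-identityˡ _)
  fromℤ-⊖ (suc m) zero    = sym (trans (cong (fromℕ (suc m) +_) -0#≈0#) (+-identityʳ _))
  fromℤ-⊖ (suc m) (suc n) = begin
    fromℤ (suc m ⊖ suc n)          ≡⟨ cong fromℤ ([1+m]⊖[1+n]≡m⊖n m n) ⟩
    fromℤ (m ⊖ n)                  ≡⟨ fromℤ-⊖ m n ⟩
    fromℕ m - fromℕ n              ≡⟨ sym ([1+x]-[1+y]≡x-y _ _) ⟩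
    fromℕ (suc m) - fromℕ (suc n)  ∎

  fromℤ-+ : ∀ i j → fromℤ (i ℤ.+ j) ≡ fromℤ i + fromℤ j
  fromℤ-+ (ℤ.+ m)  (ℤ.+ n)  = fromℕ-+ m n
  fromℤ-+ (ℤ.+ m)  -[1+ n ] = fromℤ-⊖ m (suc n)
  fromℤ-+ -[1+ m ] (ℤ.+ n)  = trans (fromℤ-⊖ n (suc m)) (+-comm _ _)
  fromℤ-+ -[1+ m ] -[1+ n ] = begin
    - fromℕ (suc (suc (m ℕ.+ n)))        ≡⟨ cong (λ k → - fromℕ (suc k)) (sym (+-suc m n)) ⟩
    - fromℕ (suc m ℕ.+ suc n)            ≡⟨ cong -_ (fromℕ-+ (suc m) (suc n)) ⟩
    - (fromℕ (suc m) + fromℕ (suc n))    ≡⟨ sym (-‿+-comm _ _) ⟩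
    - fromℕ (suc m) + - fromℕ (suc n)    ∎

  fromℤ-neg : ∀ i → fromℤ (ℤ.- i) ≡ - fromℤ i
  fromℤ-neg +0          = sym -0#≈0#
  fromℤ-neg (ℤ.+ suc n) = refl
  fromℤ-neg -[1+ n ]    = sym (-‿involutive _)

  fromℤ-+*ˡ : ∀ m j → fromℤ (ℤ.+ m ℤ.* j) ≡ fromℕ m * fromℤ j
  fromℤ-+*ˡ m (ℤ.+ n)  = trans (cong fromℤ (sym (pos-* m n))) (fromℕ-* m n)
  fromℤ-+*ˡ m -[1+ n ] = begin
    fromℤ (ℤ.+ m ℤ.* ℤ.- ℤ.+ suc n)      ≡⟨ cong fromℤ (sym (neg-distribʳ-* (ℤ.+ m) (ℤ.+ suc n))) ⟩
    fromℤ (ℤ.- (ℤ.+ m ℤ.* ℤ.+ suc n))    ≡⟨ fromℤ-neg (ℤ.+ m ℤ.* ℤ.+ suc n) ⟩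
    - fromℤ (ℤ.+ m ℤ.* ℤ.+ suc n)        ≡⟨ cong -_ (fromℤ-+*ˡ m (ℤ.+ suc n)) ⟩
    - (fromℕ m * fromℕ (suc n))          ≡⟨ -‿distribʳ-* _ _ ⟩
    fromℕ m * - fromℕ (suc n)            ∎

  fromℤ-* : ∀ i j → fromℤ (i ℤ.* j) ≡ fromℤ i * fromℤ j
  fromℤ-* (ℤ.+ m)  j = fromℤ-+*ˡ m j
  fromℤ-* -[1+ m ] j = begin
    fromℤ (ℤ.- ℤ.+ suc m ℤ.* j)        ≡⟨ cong fromℤ (sym (neg-distribˡ-* (ℤ.+ suc m) j)) ⟩
    fromℤ (ℤ.- (ℤ.+ suc m ℤ.* j))      ≡⟨ fromℤ-neg (ℤ.+ suc m ℤ.* j) ⟩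
    - fromℤ (ℤ.+ suc m ℤ.* j)          ≡⟨ cong -_ (fromℤ-+*ˡ (suc m) j) ⟩
    - (fromℕ (suc m) * fromℤ j)        ≡⟨ -‿distribˡ-* _ _ ⟩
    - fromℕ (suc m) * fromℤ j          ∎

  fromℤ-homomorphism : ℤ.+-*-rawRing -Raw-AlmostCommutative⟶ fromCommutativeRing commutativeRing
  fromℤ-homomorphism = record
    { ⟦_⟧    = fromℤ
    ; +-homo = fromℤ-+
    ; *-homo = fromℤ-*
    ; -‿homo = fromℤ-neg
    ; 0-homo = refl
    ; 1-homo = +-identityʳ 1#
    }

  fromℤ-≟ : ∀ i j → Maybe.Maybe (fromℤ i ≡ fromℤ j)
  fromℤ-≟ i j = Maybe.map (cong fromℤ) (dec⇒maybe (i ℤ.≟ j))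

  -- A constant con k denotes fromℤ k; in particular con 1ℤ is 1# + 0#, not 1#.
  open RingSolver ℤ.+-*-rawRing (fromCommutativeRing commutativeRing) fromℤ-homomorphism fromℤ-≟
    using (solve; _:=_; _:+_; _:-_; :-_; _:*_; con)

  1≢0 : 1# ≢ 0#
  1≢0 1≡0 = 0≢1 (sym 1≡0)

  -‿≢0 : ∀ {x} → x ≢ 0# → - x ≢ 0#
  -‿≢0 {x} x≢0 -x≡0 = x≢0 (trans (sym (-‿involutive x)) (trans (cong -_ -x≡0) -0#≈0#))

  x≢y⇒x-y≢0 : ∀ {x y} → x ≢ y → x - y ≢ 0#
  x≢y⇒x-y≢0 {x} {y} x≢y x-y≡0 = x≢y (x∙y⁻¹≈ε⇒x≈y x y x-y≡0)

  x-y≢0⇒x≢y : ∀ {x y} → x - y ≢ 0# → x ≢ y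
  x-y≢0⇒x≢y {x} x-y≢0 refl = x-y≢0 (-‿inverseʳ x)

  *-/-inverse : ∀ {y} x → y ≢ 0# → x * y / y ≡ x
  *-/-inverse {y} x y≢0 = begin
    x * y * y ⁻¹      ≡⟨ *-assoc x y _ ⟩
    x * (y * y ⁻¹)    ≡⟨ cong (x *_) (⁻¹-inverse y y≢0) ⟩
    x * 1#            ≡⟨ *-identityʳ x ⟩
    x                 ∎

  /-*-inverse : ∀ {y} x → y ≢ 0# → x / y * y ≡ x
  /-*-inverse {y} x y≢0 = trans (xy∙z≈xz∙y x _ y) (*-/-inverse x y≢0)

  x*y≡0⇒y≡0 : ∀ {x y} → x ≢ 0# → x * y ≡ 0# → y ≡ 0#
  x*y≡0⇒y≡0 {x} {y} x≢0 xy≡0 = begin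
    y              ≡⟨ sym (*-/-inverse y x≢0) ⟩
    y * x / x      ≡⟨ cong (_/ x) (trans (*-comm y x) xy≡0) ⟩
    0# / x         ≡⟨ zeroˡ _ ⟩
    0#             ∎

  x*y≡0⇒x≡0 : ∀ {x y} → y ≢ 0# → x * y ≡ 0# → x ≡ 0#
  x*y≡0⇒x≡0 {x} {y} y≢0 xy≡0 = x*y≡0⇒y≡0 y≢0 (trans (*-comm y x) xy≡0)

  *-preserves-≢0 : ∀ {x y} → x ≢ 0# → y ≢ 0# → x * y ≢ 0#
  *-preserves-≢0 x≢0 y≢0 xy≡0 = y≢0 (x*y≡0⇒y≡0 x≢0 xy≡0)

  /≡/⇒cross : ∀ {x y z w} → y ≢ 0# → w ≢ 0# → x / y ≡ z / w → x * w ≡ z * y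
  /≡/⇒cross {x} {y} {z} {w} y≢0 w≢0 x/y≡z/w = begin
    x * w              ≡⟨ cong (_* w) (sym (/-*-inverse x y≢0)) ⟩
    x / y * y * w      ≡⟨ cong (λ q → q * y * w) x/y≡z/w ⟩
    z / w * y * w      ≡⟨ xy∙z≈xz∙y (z / w) y w ⟩
    z / w * w * y      ≡⟨ cong (_* y) (/-*-inverse z w≢0) ⟩
    z * y              ∎

  cross⇒/≡/ : ∀ {x y z w} → y ≢ 0# → w ≢ 0# → x * w ≡ z * y → x / y ≡ z / w
  cross⇒/≡/ {x} {y} {z} {w} y≢0 w≢0 xw≡zy = begin
    x / y              ≡⟨ cong (_/ y) (sym (*-/-inverse x w≢0)) ⟩
    x * w / w / y      ≡⟨ cong (λ q → q / w / y) xw≡zy ⟩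
    z * y / w / y      ≡⟨ cong (_/ y) (xy∙z≈xz∙y z y (w ⁻¹)) ⟩
    z / w * y / y      ≡⟨ *-/-inverse (z / w) y≢0 ⟩
    z / w              ∎

  sd : Carrier → Carrier → Carrier
  sd x y = (x + y) / (x - y)

  sd-x-0 : ∀ {x} → x ≢ 0# → sd x 0# ≡ 1#
  sd-x-0 {x} x≢0 = begin
    (x + 0#) / (x - 0#)   ≡⟨ cong₂ _/_ (+-identityʳ x) (trans (cong (x +_) -0#≈0#) (+-identityʳ x)) ⟩
    x / x                 ≡⟨ ⁻¹-inverse x x≢0 ⟩
    1#                    ∎

  sd-x-[-x] : ∀ x → sd x (- x) ≡ 0#
  sd-x-[-x] x = trans (cong (_/ (x - - x)) (-‿inverseʳ x)) (zeroˡ _)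

  sd≡0⇒x+y≡0 : ∀ {x y} → x ≢ y → sd x y ≡ 0# → x + y ≡ 0#
  sd≡0⇒x+y≡0 {x} {y} x≢y sd≡0 = begin
    x + y                 ≡⟨ sym (/-*-inverse (x + y) (x≢y⇒x-y≢0 x≢y)) ⟩
    sd x y * (x - y)      ≡⟨ cong (_* (x - y)) sd≡0 ⟩
    0# * (x - y)          ≡⟨ zeroˡ _ ⟩
    0#                    ∎

  sd-≡ˡ⇒[c+c][x-y]≡0 : ∀ {c x y} → x ≢ c → y ≢ c → sd x c ≡ sd y c → (c + c) * (x - y) ≡ 0#
  sd-≡ˡ⇒[c+c][x-y]≡0 {c} {x} {y} x≢c y≢c sd≡sd = begin
    (c + c) * (x - y)                           ≡⟨ solve 3 (λ c x y → (c :+ c) :* (x :- y)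
                                                     := (y :+ c) :* (x :- c) :- (x :+ c) :* (y :- c)) refl c x y ⟩
    (y + c) * (x - c) - (x + c) * (y - c)       ≡⟨ cong (λ z → (y + c) * (x - c) - z) cross ⟩
    (y + c) * (x - c) - (y + c) * (x - c)       ≡⟨ -‿inverseʳ _ ⟩
    0#                                          ∎
    where
    cross : (x + c) * (y - c) ≡ (y + c) * (x - c)
    cross = /≡/⇒cross (x≢y⇒x-y≢0 x≢c) (x≢y⇒x-y≢0 y≢c) sd≡sd

  sd-≡ʳ⇒[c+c][x-y]≡0 : ∀ {c x y} → c ≢ x → c ≢ y → sd c x ≡ sd c y → (c + c) * (x - y) ≡ 0#
  sd-≡ʳ⇒[c+c][x-y]≡0 {c} {x} {y} c≢x c≢y sd≡sd = begin
    (c + c) * (x - y)                           ≡⟨ solve 3 (λ c x y → (c :+ c) :* (x :- y)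
                                                     := (c :+ x) :* (c :- y) :- (c :+ y) :* (c :- x)) refl c x y ⟩
    (c + x) * (c - y) - (c + y) * (c - x)       ≡⟨ cong (λ z → (c + x) * (c - y) - z) (sym cross) ⟩
    (c + x) * (c - y) - (c + x) * (c - y)       ≡⟨ -‿inverseʳ _ ⟩
    0#                                          ∎
    where
    cross : (c + x) * (c - y) ≡ (c + y) * (c - x)
    cross = /≡/⇒cross (x≢y⇒x-y≢0 c≢x) (x≢y⇒x-y≢0 c≢y) sd≡sd

  module _ (2≢0 : 1# + 1# ≢ 0#) where

    x+x≡0⇒x≡0 : ∀ {x} → x + x ≡ 0# → x ≡ 0#
    x+x≡0⇒x≡0 {x} x+x≡0 = x*y≡0⇒y≡0 2≢0 (begin
      (1# + 1#) * x      ≡⟨ distribʳ x 1# 1# ⟩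
      1# * x + 1# * x    ≡⟨ cong₂ _+_ (*-identityˡ x) (*-identityˡ x) ⟩
      x + x              ≡⟨ x+x≡0 ⟩
      0#                 ∎)

    x≢0⇒x≢-x : ∀ {x} → x ≢ 0# → x ≢ - x
    x≢0⇒x≢-x {x} x≢0 x≡-x = x≢0 (x+x≡0⇒x≡0 (trans (cong (x +_) x≡-x) (-‿inverseʳ x)))

    c≢0⇒c+c≢0 : ∀ {c} → c ≢ 0# → c + c ≢ 0#
    c≢0⇒c+c≢0 c≢0 c+c≡0 = c≢0 (x+x≡0⇒x≡0 c+c≡0)

    sd-injectiveˡ : ∀ {c x y} → c ≢ 0# → x ≢ c → y ≢ c → sd x c ≡ sd y c → x ≡ y
    sd-injectiveˡ c≢0 x≢c y≢c sd≡sd =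
      x∙y⁻¹≈ε⇒x≈y _ _ (x*y≡0⇒y≡0 (c≢0⇒c+c≢0 c≢0) (sd-≡ˡ⇒[c+c][x-y]≡0 x≢c y≢c sd≡sd))

    sd-injectiveʳ : ∀ {c x y} → c ≢ 0# → c ≢ x → c ≢ y → sd c x ≡ sd c y → x ≡ y
    sd-injectiveʳ c≢0 c≢x c≢y sd≡sd =
      x∙y⁻¹≈ε⇒x≈y _ _ (x*y≡0⇒y≡0 (c≢0⇒c+c≢0 c≢0) (sd-≡ʳ⇒[c+c][x-y]≡0 c≢x c≢y sd≡sd))

    u+d≢-[u-d] : ∀ {u d} → u ≢ 0# → u + d ≢ - (u - d)
    u+d≢-[u-d] {u} {d} u≢0 u+d≡-[u-d] = u≢0 (x+x≡0⇒x≡0 (begin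
      u + u                      ≡⟨ solve 2 (λ u d → u :+ u := (u :+ d) :+ (u :- d)) refl u d ⟩
      (u + d) + (u - d)          ≡⟨ cong (_+ (u - d)) u+d≡-[u-d] ⟩
      - (u - d) + (u - d)        ≡⟨ -‿inverseˡ (u - d) ⟩
      0#                         ∎))

  sd-scale : ∀ {c x y} → c ≢ 0# → x ≢ y → sd (c * x) (c * y) ≡ sd x y
  sd-scale {c} {x} {y} c≢0 x≢y = cross⇒/≡/ cx-cy≢0 (x≢y⇒x-y≢0 x≢y)
    (solve 3 (λ c x y → (c :* x :+ c :* y) :* (x :- y) := (x :+ y) :* (c :* x :- c :* y)) refl c x y)
    where
    cx-cy≢0 : c * x - c * y ≢ 0#
    cx-cy≢0 = subst (_≢ 0#) (x[y-z]≈xy-xz c x y) (*-preserves-≢0 c≢0 (x≢y⇒x-y≢0 x≢y))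

  sd-[u+d]-[-[u-d]] : ∀ {u d} → u ≢ 0# → u + d ≢ - (u - d) → sd (u + d) (- (u - d)) ≡ d / u
  sd-[u+d]-[-[u-d]] {u} {d} u≢0 ne = cross⇒/≡/ (x≢y⇒x-y≢0 ne) u≢0
    (solve 2 (λ u d → ((u :+ d) :+ :- (u :- d)) :* u := d :* ((u :+ d) :- :- (u :- d))) refl u d)

  sd-[-[u+d]]-[u-d] : ∀ {u d} → u ≢ 0# → - (u + d) ≢ u - d → sd (- (u + d)) (u - d) ≡ d / u
  sd-[-[u+d]]-[u-d] {u} {d} u≢0 ne = cross⇒/≡/ (x≢y⇒x-y≢0 ne) u≢0
    (solve 2 (λ u d → (:- (u :+ d) :+ (u :- d)) :* u := d :* (:- (u :+ d) :- (u :- d))) refl u d)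

  progression-0 : ∀ a d → a + fromℤ 0ℤ * d ≡ a
  progression-0 = solve 2 (λ a d → a :+ con 0ℤ :* d := a) refl

  progression-suc : ∀ a d i → a + fromℤ (ℤ.suc i) * d ≡ (a + fromℤ i * d) + d
  progression-suc a d i = begin
    a + fromℤ (1ℤ ℤ.+ i) * d           ≡⟨ cong (λ k → a + k * d) (fromℤ-+ 1ℤ i) ⟩
    a + (fromℤ 1ℤ + fromℤ i) * d       ≡⟨ solve 3 (λ a d k → a :+ (con 1ℤ :+ k) :* d := (a :+ k :* d) :+ d)
                                                  refl a d (fromℤ i) ⟩
    (a + fromℤ i * d) + d              ∎

  progression-pred : ∀ a d i → a + fromℤ (ℤ.pred i) * d ≡ (a + fromℤ i * d) - d
  progression-pred a d i = begin
    a + fromℤ (-1ℤ ℤ.+ i) * d          ≡⟨ cong (λ k → a + k * d) (fromℤ-+ -1ℤ i) ⟩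
    a + (fromℤ -1ℤ + fromℤ i) * d      ≡⟨ solve 3 (λ a d k → a :+ (con -1ℤ :+ k) :* d := (a :+ k :* d) :- d)
                                                  refl a d (fromℤ i) ⟩
    (a + fromℤ i * d) - d              ∎

  module SDMap (2≢0 : 1# + 1# ≢ 0#) (f : Carrier → Carrier) (isSD : IsSDMap f) where

    Fixed : Carrier → Set c
    Fixed x = f x ≡ x

    f-injective : ∀ {x y} → x ≢ y → f x ≢ f y
    f-injective {x} {y} x≢y = proj₁ (isSD x y x≢y)

    f-sd : ∀ {x y} → x ≢ y → f (sd x y) ≡ sd (f x) (f y)
    f-sd {x} {y} x≢y = proj₂ (isSD x y x≢y)

    fixed-sd : ∀ {x y} → x ≢ y → Fixed x → Fixed y → Fixed (sd x y)
    fixed-sd x≢y fx fy = trans (f-sd x≢y) (cong₂ sd fx fy)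

    f0≡0 : f 0# ≡ 0#
    f0≡0 = x+x≡0⇒x≡0 2≢0 (x*y≡0⇒x≡0 (x≢y⇒x-y≢0 (f-injective 1≢-1)) [f0+f0][f1-f[-1]]≡0)
      where
      -1≢0 : - 1# ≢ 0#
      -1≢0 = -‿≢0 1≢0
      1≢-1 : 1# ≢ - 1#
      1≢-1 = x≢0⇒x≢-x 2≢0 1≢0
      f1≡sd-fx-f0 : ∀ {x} → x ≢ 0# → f 1# ≡ sd (f x) (f 0#)
      f1≡sd-fx-f0 {x} x≢0 = trans (cong f (sym (sd-x-0 x≢0))) (f-sd x≢0)
      [f0+f0][f1-f[-1]]≡0 : (f 0# + f 0#) * (f 1# - f (- 1#)) ≡ 0#
      [f0+f0][f1-f[-1]]≡0 = sd-≡ˡ⇒[c+c][x-y]≡0 (f-injective 1≢0) (f-injective -1≢0)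
                              (trans (sym (f1≡sd-fx-f0 1≢0)) (f1≡sd-fx-f0 -1≢0))

    f1≡1 : Fixed 1#
    f1≡1 = begin
      f 1#                  ≡⟨ cong f (sym (sd-x-0 1≢0)) ⟩
      f (sd 1# 0#)          ≡⟨ f-sd 1≢0 ⟩
      sd (f 1#) (f 0#)      ≡⟨ cong (sd (f 1#)) f0≡0 ⟩
      sd (f 1#) 0#          ≡⟨ sd-x-0 (subst (f 1# ≢_) f0≡0 (f-injective 1≢0)) ⟩
      1#                    ∎

    f-odd : ∀ {x} → x ≢ 0# → f (- x) ≡ - f x
    f-odd {x} x≢0 = +-inverseʳ-unique (f x) (f (- x)) (sd≡0⇒x+y≡0 (f-injective x≢-x) (begin
      sd (f x) (f (- x))    ≡⟨ sym (f-sd x≢-x) ⟩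
      f (sd x (- x))        ≡⟨ cong f (sd-x-[-x] x) ⟩
      f 0#                  ≡⟨ f0≡0 ⟩
      0#                    ∎))
      where
      x≢-x : x ≢ - x
      x≢-x = x≢0⇒x≢-x 2≢0 x≢0

    fixed-neg : ∀ {x} → x ≢ 0# → Fixed x → Fixed (- x)
    fixed-neg x≢0 fx = trans (f-odd x≢0) (cong -_ fx)

    fixed-of-sdˡ : ∀ {c x} → c ≢ 0# → x ≢ c → Fixed c → Fixed (sd x c) → Fixed x
    fixed-of-sdˡ {c} {x} c≢0 x≢c fc fsd = sd-injectiveˡ 2≢0 c≢0 fx≢c x≢c (begin
      sd (f x) c            ≡⟨ cong (sd (f x)) (sym fc) ⟩
      sd (f x) (f c)        ≡⟨ sym (f-sd x≢c) ⟩
      f (sd x c)            ≡⟨ fsd ⟩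
      sd x c                ∎)
      where
      fx≢c : f x ≢ c
      fx≢c = subst (f x ≢_) fc (f-injective x≢c)

    fixed-of-sdʳ : ∀ {c x} → c ≢ 0# → c ≢ x → Fixed c → Fixed (sd c x) → Fixed x
    fixed-of-sdʳ {c} {x} c≢0 c≢x fc fsd = sd-injectiveʳ 2≢0 c≢0 c≢fx c≢x (begin
      sd c (f x)            ≡⟨ cong (λ z → sd z (f x)) (sym fc) ⟩
      sd (f c) (f x)        ≡⟨ sym (f-sd c≢x) ⟩
      f (sd c x)            ≡⟨ fsd ⟩
      sd c x                ∎)
      where
      c≢fx : c ≢ f x
      c≢fx = subst (_≢ f x) fc (f-injective c≢x)

    fixed-/ : ∀ {q d} → q ≢ 0# → q ≢ d → Fixed q → Fixed d → Fixed (d / q)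
    fixed-/ {q} {d} q≢0 q≢d fq fd =
      fixed-of-sdˡ 1≢0 t≢1 f1≡1 (subst Fixed sd-d-q≡sd-t-1 (fixed-sd d≢q fd fq))
      where
      t : Carrier
      t = d / q
      d≢q : d ≢ q
      d≢q d≡q = q≢d (sym d≡q)
      qt≡d : q * t ≡ d
      qt≡d = trans (*-comm q t) (/-*-inverse d q≢0)
      t≢1 : t ≢ 1#
      t≢1 t≡1 = q≢d (trans (sym (*-identityʳ q)) (trans (cong (q *_) (sym t≡1)) qt≡d))
      sd-d-q≡sd-t-1 : sd d q ≡ sd t 1#
      sd-d-q≡sd-t-1 = trans (sym (cong₂ sd qt≡d (*-identityʳ q))) (sd-scale q≢0 t≢1)

    fixed-step-up : ∀ {u d} → u ≢ 0# → u - d ≢ 0# →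
                    Fixed d → Fixed (u - d) → Fixed u → Fixed (u + d)
    fixed-step-up {u} {d} u≢0 u-d≢0 fd fu-d fu =
      fixed-of-sdˡ (-‿≢0 u-d≢0) ne (fixed-neg u-d≢0 fu-d)
        (subst Fixed (sym (sd-[u+d]-[-[u-d]] u≢0 ne)) (fixed-/ u≢0 (x-y≢0⇒x≢y u-d≢0) fu fd))
      where
      ne : u + d ≢ - (u - d)
      ne = u+d≢-[u-d] 2≢0 u≢0

    fixed-step-down : ∀ {u d} → u ≢ 0# → u - d ≢ 0# → u + d ≢ 0# →
                      Fixed d → Fixed (u + d) → Fixed u → Fixed (u - d)
    fixed-step-down {u} {d} u≢0 u-d≢0 u+d≢0 fd fu+d fu =
      fixed-of-sdʳ (-‿≢0 u+d≢0) ne (fixed-neg u+d≢0 fu+d)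
        (subst Fixed (sym (sd-[-[u+d]]-[u-d] u≢0 ne)) (fixed-/ u≢0 (x-y≢0⇒x≢y u-d≢0) fu fd))
      where
      ne : - (u + d) ≢ u - d
      ne -[u+d]≡u-d = u+d≢-[u-d] 2≢0 u≢0 (trans (sym (-‿involutive (u + d))) (cong -_ -[u+d]≡u-d))

charZero⇒1+1≢0 : ∀ {c} (F : Field c) → let open Field F in CharZero → 1# + 1# ≢ 0#
charZero⇒1+1≢0 F charZero 1+1≡0 = charZero 1 (trans (cong (1# +_) (+-identityʳ 1#)) 1+1≡0)
  where open Field F hiding (refl; sym; trans)

lemma5p1 : {c : Level} (F : Field c) → let open Field F in
    CharZero →
    (a d : Carrier) →
    (∀ (n : ℤ) → ¬ (a + fromℤ n * d ≡ 0#)) →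
    (f : Carrier → Carrier) → IsSDMap f →
    f a ≡ a → f (a + d) ≡ a + d → f d ≡ d →
    ∀ (n : ℤ) → f (a + fromℤ n * d) ≡ a + fromℤ n * d
lemma5p1 F charZero a d a+nd≢0 f isSD fa fa+d fd = ℤ-twoStep-induction P P0 P1 up down
  where
  open Field F hiding (refl; sym; trans)
  open FieldProperties F
  open SDMap (charZero⇒1+1≢0 F charZero) f isSD

  term : ℤ → Carrier
  term n = a + fromℤ n * d

  P : ℤ → Set _
  P n = Fixed (term n)

  term-suc : ∀ i → term (ℤ.suc i) ≡ term i + d
  term-suc = progression-suc a d

  term-pred : ∀ i → term (ℤ.pred i) ≡ term i - d
  term-pred = progression-pred a d

  term-pred≢0 : ∀ i → term i - d ≢ 0#
  term-pred≢0 i = subst (_≢ 0#) (term-pred i) (a+nd≢0 (ℤ.pred i))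

  P0 : P 0ℤ
  P0 = subst Fixed (sym (progression-0 a d)) fa

  P1 : P 1ℤ
  P1 = subst Fixed (sym (trans (term-suc 0ℤ) (cong (_+ d) (progression-0 a d)))) fa+d

  up : ∀ i → P (ℤ.pred i) → P i → P (ℤ.suc i)
  up i Ppred Pi = subst Fixed (sym (term-suc i))
    (fixed-step-up (a+nd≢0 i) (term-pred≢0 i) fd (subst Fixed (term-pred i) Ppred) Pi)

  down : ∀ i → P (ℤ.suc i) → P i → P (ℤ.pred i)
  down i Psuc Pi = subst Fixed (sym (term-pred i))
    (fixed-step-down (a+nd≢0 i) (term-pred≢0 i) (subst (_≢ 0#) (term-suc i) (a+nd≢0 (ℤ.suc i)))
      fd (subst Fixed (term-suc i) Psuc) Pi)
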